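{- Suppose there is a function $f:E\times\mathbb N\to E$ such that for all $\alpha\in E$, $d\in\mathbb N$ and all sequents $\Gamma$, $\vdash^\alpha_d\Gamma$ implies $\vdash^{f(\alpha,d)}_0\Gamma$. If $\mathsf{TI}_{\lhd}$ is a theorem of $\mathsf{PA}[X]$, then $(\mathbb N,\lhd)\lesssim(E\restriction\alpha,\prec)$ for some $\alpha\in E$. Consequently, $\mathsf{PA}[X]$ cannot prove $\mathsf{TI}_{\lhd}$ when $(E,\prec)\lesssim(\mathbb N,\lhd)$.
   Context: $\mathcal L_{\mathsf{PA}}$ is the first-order language with constant $0$, unary function $S$, binary functions $+,\times$ and binary relations $\leq,=$; $\mathcal L^X_{\mathsf{PA}}$ adds a unary relation symbol $X$. $\overline n$ is the $n$-th numeral. Formulas are in negation normal form: built from literals (prime formulas and their negations) by $\land,\lor,\forall,\exists$; the negation $\neg\varphi$ of a formula is defined via de Morgan's laws (swapping a prime formula with its negation, $\land$ with $\lor$, $\forall$ with $\exists$), and $\varphi\to\psi$ abbreviates $\neg\varphi\lor\psi$. "True" refers to the standard model $\mathbb N$. Rank: $\mathrm{rk}$ of a literal is $0$, $\mathrm{rk}(\varphi_0\land\varphi_1)=\mathrm{rk}(\varphi_0\lor\varphi_1)=\max(\mathrm{rk}\varphi_0,\mathrm{rk}\varphi_1)+1$, $\mathrm{rk}(\forall x\varphi)=\mathrm{rk}(\exists x\varphi)=\mathrm{rk}(\varphi)+1$. $\mathsf{PA}[X]$ is the $\mathcal L^X_{\mathsf{PA}}$-theory with the equality axioms (for the extended language),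 the axioms of Robinson arithmetic, and all induction axioms $\varphi[x/0]\land\forall x(\varphi\to\varphi[x/Sx])\to\forall x\varphi$ for $\mathcal L^X_{\mathsf{PA}}$-formulas $\varphi$. $(E,\prec)$ is a well order with a map $\alpha\mapsto\alpha+1$ satisfying $\alpha\prec\alpha+1$, and elements $0,\omega\in E$ with $0\prec\omega$ such that $\alpha\prec\omega$ implies $\alpha+1\prec\omega$. $E\restriction\alpha=\{\gamma\in E:\gamma\prec\alpha\}$. $x\lhd y$ is a fixed $\mathcal L_{\mathsf{PA}}$-formula with free variables $x,y$ only, defining a well order $\lhd$ on $\mathbb N$. $\forall y\lhd x.\varphi$ abbreviates $\forall y(y\lhd x\to\varphi)$; $\mathsf{Prog}_{\lhd}:\equiv\forall x(\forall y\lhd x.Xy\to Xx)$ and $\mathsf{TI}_{\lhd}:\equiv\mathsf{Prog}_{\lhd}\to\forall x.Xx$. For well orders, $(A,<_A)\lesssim(B,<_B)$ means there is $g:A\to B$ with $a<_A a'\Rightarrow g(a)<_B g(a')$. A sequent is a finite set of $\mathcal L^X_{\mathsf{PA}}$-sentences; $\Gamma,\varphi$ denotes $\Gamma\cup\{\varphi\}$. By recursion on $\alpha\in E$, $\vdash^\alpha_d\Gamma$ (for $d\in\mathbb N$) holds exactly if one of: (i) $\Gamma$ contains a true $\mathcal L_{\mathsf{PA}}$-literal, or formulas $Xs$ and $\neg Xt$ with closed terms $s,t$ of equal value; (ii) $\Gamma$ contains $\varphi_0\land\varphi_1$ (resp. $\varphi_0\lor\varphi_1$) and for every (resp. some) $i\in\{0,1\}$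 there are $\alpha(i)\prec\alpha$, $d(i)\leq d$, $\Delta_i\subseteq\Gamma,\varphi_i$ with $\vdash^{\alpha(i)}_{d(i)}\Delta_i$; (iii) $\Gamma$ contains $\forall x\varphi$ (resp. $\exists x\varphi$) and for every (resp. some) closed term $t$ there are $\alpha(t)\prec\alpha$, $d(t)\leq d$, $\Delta_t\subseteq\Gamma,\varphi[x/t]$ with $\vdash^{\alpha(t)}_{d(t)}\Delta_t$; (iv) $\Gamma$ contains $Xt$ and for every closed term $s$ with $s\lhd t$ (by value) there are $\alpha(s)\prec\alpha$, $d(s)\leq d$, $\Delta_s\subseteq\Gamma,Xs$ with $\vdash^{\alpha(s)}_{d(s)}\Delta_s$; (v) for some sentence $\varphi$ with $\mathrm{rk}(\varphi)<d$ and each $i\in\{0,1\}$ there are $\alpha(i)\prec\alpha$, $d(i)\leq d$ with $\vdash^{\alpha(0)}_{d(0)}\Delta_0$, $\vdash^{\alpha(1)}_{d(1)}\Delta_1$, $\Delta_0\subseteq\Gamma,\varphi$, $\Delta_1\subseteq\Gamma,\neg\varphi$. -}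

module Defs where

open import Data.Nat using (ℕ; zero; suc; _+_; _*_; _≤_; _<_)
open import Data.Fin using (Fin; zero; suc)
open import Data.Bool using (Bool; true; false)
open import Data.List using (List; []; _∷_; map)
open import Data.List.Membership.Propositional using (_∈_)
open import Data.List.Relation.Binary.Subset.Propositional using (_⊆_)
open import Data.List.Relation.Unary.All using (All)
open import Data.Product using (Σ; _×_; _,_; proj₁)
open import Data.Sum using (_⊎_)
open import Data.Empty using (⊥)
open import Data.Unit using (⊤)
open import Relation.Nullary using (¬_)
open import Relation.Binary.PropositionalEquality using (_≡_; _≢_)
open import Induction.WellFounded using (WellFounded)

-- Syntax of L^X_PA (de Bruijn / scoped: Tm n, Fm n have n free variables)

data Tm (n : ℕ) : Set where
  var  : Fin n → Tm n
  zer  : Tm n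
  S    : Tm n → Tm n
  _⊕_  : Tm n → Tm n → Tm n
  _⊗_  : Tm n → Tm n → Tm n

-- formulas in negation normal form
data Fm (n : ℕ) : Set where
  eq neq le nle : Tm n → Tm n → Fm n
  X nX          : Tm n → Fm n
  and or        : Fm n → Fm n → Fm n
  all ex        : Fm (suc n) → Fm n

Sentence : Set
Sentence = Fm 0

IsPA : ∀ {n} → Fm n → Set
IsPA (eq _ _)  = ⊤
IsPA (neq _ _) = ⊤
IsPA (le _ _)  = ⊤
IsPA (nle _ _) = ⊤
IsPA (X _)     = ⊥
IsPA (nX _)    = ⊥
IsPA (and φ ψ) = IsPA φ × IsPA ψ
IsPA (or φ ψ)  = IsPA φ × IsPA ψ
IsPA (all φ)   = IsPA φ
IsPA (ex φ)    = IsPA φ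

IsLiteral : ∀ {n} → Fm n → Set
IsLiteral (eq _ _)  = ⊤
IsLiteral (neq _ _) = ⊤
IsLiteral (le _ _)  = ⊤
IsLiteral (nle _ _) = ⊤
IsLiteral (X _)     = ⊤
IsLiteral (nX _)    = ⊤
IsLiteral (and _ _) = ⊥
IsLiteral (or _ _)  = ⊥
IsLiteral (all _)   = ⊥
IsLiteral (ex _)    = ⊥

neg : ∀ {n} → Fm n → Fm n
neg (eq s t)  = neq s t
neg (neq s t) = eq s t
neg (le s t)  = nle s t
neg (nle s t) = le s t
neg (X t)     = nX t
neg (nX t)    = X t
neg (and φ ψ) = or (neg φ) (neg ψ)
neg (or φ ψ)  = and (neg φ) (neg ψ)
neg (all φ)   = ex (neg φ)
neg (ex φ)    = all (neg φ)

_⇒_ : ∀ {n} → Fm n → Fm n → Fm n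
φ ⇒ ψ = or (neg φ) ψ

rk : ∀ {n} → Fm n → ℕ
rk (and φ ψ) = suc (rk φ Data.Nat.⊔ rk ψ)
rk (or φ ψ)  = suc (rk φ Data.Nat.⊔ rk ψ)
rk (all φ)   = suc (rk φ)
rk (ex φ)    = suc (rk φ)
rk _         = 0

renT : ∀ {n m} → (Fin n → Fin m) → Tm n → Tm m
renT ρ (var i) = var (ρ i)
renT ρ zer     = zer
renT ρ (S t)   = S (renT ρ t)
renT ρ (s ⊕ t) = renT ρ s ⊕ renT ρ t
renT ρ (s ⊗ t) = renT ρ s ⊗ renT ρ t

subT : ∀ {n m} → (Fin n → Tm m) → Tm n → Tm m
subT σ (var i) = σ i
subT σ zer     = zer
subT σ (S t)   = S (subT σ t)
subT σ (s ⊕ t) = subT σ s ⊕ subT σ t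
subT σ (s ⊗ t) = subT σ s ⊗ subT σ t

liftR : ∀ {n m} → (Fin n → Fin m) → Fin (suc n) → Fin (suc m)
liftR ρ zero    = zero
liftR ρ (suc i) = suc (ρ i)

liftS : ∀ {n m} → (Fin n → Tm m) → Fin (suc n) → Tm (suc m)
liftS σ zero    = var zero
liftS σ (suc i) = renT suc (σ i)

ren : ∀ {n m} → (Fin n → Fin m) → Fm n → Fm m
ren ρ (eq s t)  = eq (renT ρ s) (renT ρ t)
ren ρ (neq s t) = neq (renT ρ s) (renT ρ t)
ren ρ (le s t)  = le (renT ρ s) (renT ρ t)
ren ρ (nle s t) = nle (renT ρ s) (renT ρ t)
ren ρ (X t)     = X (renT ρ t)
ren ρ (nX t)    = nX (renT ρ t)
ren ρ (and φ ψ) = and (ren ρ φ) (ren ρ ψ)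
ren ρ (or φ ψ)  = or (ren ρ φ) (ren ρ ψ)
ren ρ (all φ)   = all (ren (liftR ρ) φ)
ren ρ (ex φ)    = ex (ren (liftR ρ) φ)

sub : ∀ {n m} → (Fin n → Tm m) → Fm n → Fm m
sub σ (eq s t)  = eq (subT σ s) (subT σ t)
sub σ (neq s t) = neq (subT σ s) (subT σ t)
sub σ (le s t)  = le (subT σ s) (subT σ t)
sub σ (nle s t) = nle (subT σ s) (subT σ t)
sub σ (X t)     = X (subT σ t)
sub σ (nX t)    = nX (subT σ t)
sub σ (and φ ψ) = and (sub σ φ) (sub σ ψ)
sub σ (or φ ψ)  = or (sub σ φ) (sub σ ψ)
sub σ (all φ)   = all (sub (liftS σ) φ)
sub σ (ex φ)    = ex (sub (liftS σ) φ)

inst : ∀ {n} → Tm n → Fin (suc n) → Tm n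
inst t zero    = t
inst t (suc i) = var i

_[_] : ∀ {n} → Fm (suc n) → Tm n → Fm n
φ [ t ] = sub (inst t) φ

wk : ∀ {n} → Fm n → Fm (suc n)
wk = ren suc

evalT : ∀ {n} → (Fin n → ℕ) → Tm n → ℕ
evalT ρ (var i) = ρ i
evalT ρ zer     = 0
evalT ρ (S t)   = suc (evalT ρ t)
evalT ρ (s ⊕ t) = evalT ρ s + evalT ρ t
evalT ρ (s ⊗ t) = evalT ρ s * evalT ρ t

val : Tm 0 → ℕ
val = evalT (λ ())

extend : ∀ {n} → ℕ → (Fin n → ℕ) → Fin (suc n) → ℕ
extend m ρ zero    = m
extend m ρ (suc i) = ρ i

Sat : ∀ {n} → (ℕ → Set) → (Fin n → ℕ) → Fm n → Set
Sat P ρ (eq s t)  = evalT ρ s ≡ evalT ρ t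
Sat P ρ (neq s t) = evalT ρ s ≢ evalT ρ t
Sat P ρ (le s t)  = evalT ρ s ≤ evalT ρ t
Sat P ρ (nle s t) = ¬ (evalT ρ s ≤ evalT ρ t)
Sat P ρ (X t)     = P (evalT ρ t)
Sat P ρ (nX t)    = ¬ P (evalT ρ t)
Sat P ρ (and φ ψ) = Sat P ρ φ × Sat P ρ ψ
Sat P ρ (or φ ψ)  = Sat P ρ φ ⊎ Sat P ρ ψ
Sat P ρ (all φ)   = (m : ℕ) → Sat P (extend m ρ) φ
Sat P ρ (ex φ)    = Σ ℕ λ m → Sat P (extend m ρ) φ

TrueLit : Sentence → Set
TrueLit (eq s t)  = val s ≡ val t
TrueLit (neq s t) = val s ≢ val t
TrueLit (le s t)  = val s ≤ val t
TrueLit (nle s t) = ¬ (val s ≤ val t)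
TrueLit _         = ⊥

-- The formula x ⊲ y.  Convention: lt : Fm 2 with x = var zero and
-- y = var (suc zero).  'lhd s t' is the formula  s ⊲ t.

lhd : ∀ {n} → Fm 2 → Tm n → Tm n → Fm n
lhd lt s t = sub σ lt
  where
  σ : Fin 2 → Tm _
  σ zero       = s
  σ (suc zero) = t

-- the relation on ℕ defined by lt (X does not occur in lt; any
-- interpretation of X could be used)
_⟨_⟩_ : ℕ → Fm 2 → ℕ → Set
m ⟨ lt ⟩ n = Sat (λ _ → ⊥) ρ lt
  where
  ρ : Fin 2 → ℕ
  ρ zero       = m
  ρ (suc zero) = n

-- Prog_⊲ ≡ ∀x(∀y(y ⊲ x → Xy) → Xx),   TI_⊲ ≡ Prog_⊲ → ∀x Xx
Prog : Fm 2 → Sentence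
Prog lt = all ((all (lhd lt (var zero) (var (suc zero)) ⇒ X (var zero))) ⇒ X (var zero))

TI : Fm 2 → Sentence
TI lt = Prog lt ⇒ all (X (var zero))

record IsWellOrder {A : Set} (_<_ : A → A → Set) : Set where
  field
    irrefl : ∀ {a} → ¬ (a < a)
    trans  : ∀ {a b c} → a < b → b < c → a < c
    tri    : ∀ a b → a < b ⊎ a ≡ b ⊎ b < a
    wf     : WellFounded _<_

_≲_ : ∀ {A B : Set} → (A → A → Set) → (B → B → Set) → Set
_≲_ {A} {B} _<A_ _<B_ = Σ (A → B) λ g → ∀ a a' → a <A a' → g a <B g a'

record OrdStruct : Set₁ where
  field
    E         : Set
    _≺_       : E → E → Set
    isWO      : IsWellOrder _≺_
    _+1       : E → E
    <+1       : ∀ α → α ≺ (α +1)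
    o0        : E
    ω         : E
    o0≺ω      : o0 ≺ ω
    ω-closed  : ∀ {α} → α ≺ ω → (α +1) ≺ ω

  Below : E → Set
  Below α = Σ E λ γ → γ ≺ α

  _≺↾_ : ∀ {α} → Below α → Below α → Set
  a ≺↾ b = proj₁ a ≺ proj₁ b

-- The infinitary system ⊢^α_d Γ  (sequents as lists; only membership
-- matters, so this is the finite-set reading)

Sequent : Set
Sequent = List Sentence

module Infinitary (O : OrdStruct) (lt : Fm 2) where
  open OrdStruct O

  mutual
    data Prem (α : E) (d : ℕ) (Γ' : Sequent) : Set where
      prem : (α' : E) (d' : ℕ) (Δ : Sequent) →
             α' ≺ α → d' ≤ d → Δ ⊆ Γ' → Der α' d' Δ → Prem α d Γ'

    data Der (α : E) (d : ℕ) (Γ : Sequent) : Set where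
      axLit : (l : Sentence) → l ∈ Γ → TrueLit l → Der α d Γ
      axX   : (s t : Tm 0) → X s ∈ Γ → nX t ∈ Γ → val s ≡ val t → Der α d Γ
      ∧I    : (φ₀ φ₁ : Sentence) → and φ₀ φ₁ ∈ Γ →
              Prem α d (φ₀ ∷ Γ) → Prem α d (φ₁ ∷ Γ) → Der α d Γ
      ∨I    : (φ₀ φ₁ : Sentence) → or φ₀ φ₁ ∈ Γ →
              (i : Bool) → Prem α d ((if′ i φ₁ φ₀) ∷ Γ) → Der α d Γ
      ∀I    : (φ : Fm 1) → all φ ∈ Γ →
              ((t : Tm 0) → Prem α d (φ [ t ] ∷ Γ)) → Der α d Γ
      ∃I    : (φ : Fm 1) → ex φ ∈ Γ →
              (t : Tm 0) → Prem α d (φ [ t ] ∷ Γ) → Der α d Γ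
      XI    : (t : Tm 0) → X t ∈ Γ →
              ((s : Tm 0) → val s ⟨ lt ⟩ val t → Prem α d (X s ∷ Γ)) → Der α d Γ
      cut   : (φ : Sentence) → rk φ < d →
              Prem α d (φ ∷ Γ) → Prem α d (neg φ ∷ Γ) → Der α d Γ

    if′ : Bool → Sentence → Sentence → Sentence
    if′ true  a b = a
    if′ false a b = b

-- First-order provability: a Tait-style sequent calculus with cut
-- (eigenvariable = the fresh de Bruijn variable 'var zero')

data Tait : (n : ℕ) → List (Fm n) → Set where
  ax   : ∀ {n Γ} (A : Fm n) → IsLiteral A → A ∈ Γ → neg A ∈ Γ → Tait n Γ
  andR : ∀ {n Γ} (A B : Fm n) → and A B ∈ Γ →
         Tait n (A ∷ Γ) → Tait n (B ∷ Γ) → Tait n Γ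
  orR₀ : ∀ {n Γ} (A B : Fm n) → or A B ∈ Γ → Tait n (A ∷ Γ) → Tait n Γ
  orR₁ : ∀ {n Γ} (A B : Fm n) → or A B ∈ Γ → Tait n (B ∷ Γ) → Tait n Γ
  allR : ∀ {n Γ} (A : Fm (suc n)) → all A ∈ Γ →
         Tait (suc n) (A ∷ map wk Γ) → Tait n Γ
  exR  : ∀ {n Γ} (A : Fm (suc n)) → ex A ∈ Γ → (t : Tm n) →
         Tait n (A [ t ] ∷ Γ) → Tait n Γ
  cutR : ∀ {n Γ} (A : Fm n) → Tait n (A ∷ Γ) → Tait n (neg A ∷ Γ) → Tait n Γ

closeAll : ∀ k → Fm k → Sentence
closeAll zero    φ = φ
closeAll (suc k) φ = closeAll k (all φ)

v0 : ∀ {n} → Tm (suc n)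
v0 = var zero
v1 : ∀ {n} → Tm (suc (suc n))
v1 = var (suc zero)
v2 : ∀ {n} → Tm (suc (suc (suc n)))
v2 = var (suc (suc zero))
v3 : ∀ {n} → Tm (suc (suc (suc (suc n))))
v3 = var (suc (suc (suc zero)))

stepSub : ∀ {k} → Fin (suc k) → Tm (suc k)
stepSub zero    = S (var zero)
stepSub (suc i) = var (suc i)

IndBody : ∀ {k} → Fm (suc k) → Fm k
IndBody φ = and (φ [ zer ]) (all (φ ⇒ sub stepSub φ)) ⇒ all φ

data AxiomPAX : Sentence → Set where
  eqRefl : AxiomPAX (all (eq v0 v0))
  eqS    : AxiomPAX (closeAll 2 (eq v0 v1 ⇒ eq (S v0) (S v1)))
  eqPlus : AxiomPAX (closeAll 4 (and (eq v0 v1) (eq v2 v3) ⇒ eq (v0 ⊕ v2) (v1 ⊕ v3)))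
  eqTimes : AxiomPAX (closeAll 4 (and (eq v0 v1) (eq v2 v3) ⇒ eq (v0 ⊗ v2) (v1 ⊗ v3)))
  eqEq   : AxiomPAX (closeAll 4 (and (eq v0 v1) (eq v2 v3) ⇒ (eq v0 v2 ⇒ eq v1 v3)))
  eqLe   : AxiomPAX (closeAll 4 (and (eq v0 v1) (eq v2 v3) ⇒ (le v0 v2 ⇒ le v1 v3)))
  eqX    : AxiomPAX (closeAll 2 (eq v0 v1 ⇒ (X v0 ⇒ X v1)))
  Q1 : AxiomPAX (all (neq (S v0) zer))
  Q2 : AxiomPAX (closeAll 2 (eq (S v0) (S v1) ⇒ eq v0 v1))
  Q3 : AxiomPAX (all (or (eq v0 zer) (ex (eq v1 (S v0)))))
  Q4 : AxiomPAX (all (eq (v0 ⊕ zer) v0))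
  Q5 : AxiomPAX (closeAll 2 (eq (v0 ⊕ S v1) (S (v0 ⊕ v1))))
  Q6 : AxiomPAX (all (eq (v0 ⊗ zer) zer))
  Q7 : AxiomPAX (closeAll 2 (eq (v0 ⊗ S v1) ((v0 ⊗ v1) ⊕ v0)))
  Q8 : AxiomPAX (closeAll 2 (and (le v0 v1 ⇒ ex (eq (v1 ⊕ v0) v2))
                                  (ex (eq (v1 ⊕ v0) v2) ⇒ le v0 v1)))
  ind : ∀ k (φ : Fm (suc k)) → AxiomPAX (closeAll k (IndBody φ))

-- PA[X] ⊢ φ : φ is derivable from finitely many axioms
PAX⊢_ : Sentence → Set
PAX⊢ φ = Σ (List Sentence) λ As → All AxiomPAX As × Tait 0 (φ ∷ map neg As)

-- Embed PA[X] into the infinitary system: every axiom, induction included, has a derivation,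
-- and a Tait proof embeds with its finite height and cut rank.  Cutting the axioms and ¬TI against
-- a proof of TI gives ⊢ ∀x X x, which the hypothesis f turns into a cut-free derivation of some
-- height β.  Cut-free derivations of X-positive sequents are sound when X is read as
-- "has ⊲-rank at most γ" for the height γ of the derivation, so every n has ⊲-rank at most β,
-- and n ↦ least such rank is an order embedding of ⊲ into E↾(β+1).  If moreover E ≲ (ℕ, ⊲),
-- composing gives a strictly monotone self-map of E pushing α below itself, which is
-- impossible in a well order.

module Submission where

open import Defs
open import Level using (0ℓ)
open import Axiom.ExcludedMiddle using (ExcludedMiddle)
open import Function using (id; _∘_)
open import Data.Nat using (ℕ; zero; suc; _+_; _*_; _∸_; _≤_; z≤n; s≤s; _⊔_; _≟_; _≤?_)
open import Data.Nat.Properties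
  using (≤-refl; m≤m⊔n; m≤n⊔m; m⊔n≤o⇒m≤o; m⊔n≤o⇒n≤o; m≤n⇒m≤o⊔n; m≤n⇒m≤1+n; m≤m+n; m+[n∸m]≡n;
         +-identityʳ; +-suc; +-comm; *-zeroʳ; *-suc; suc-injective)
open import Data.Fin using (Fin; zero; suc)
open import Data.Bool using (true; false)
open import Data.Product using (Σ; _×_; _,_; proj₁; proj₂)
open import Data.Sum using (_⊎_; inj₁; inj₂; swap)
import Data.Sum as Sum
open import Data.Empty using (⊥; ⊥-elim)
open import Data.Unit using (⊤; tt)
open import Data.List using ([]; _∷_; map)
open import Data.List.Membership.Propositional using (_∈_; find; lose)
open import Data.List.Membership.Propositional.Properties using (∈-map⁺)
open import Data.List.Relation.Binary.Subset.Propositional using (_⊆_)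
open import Data.List.Relation.Binary.Subset.Propositional.Properties using (Any-resp-⊆)
open import Data.List.Relation.Unary.Any using (Any; here; there)
open import Data.List.Relation.Unary.All using (All; []; _∷_; lookup)
open import Data.List.Relation.Unary.All.Properties using (anti-mono)
open import Relation.Nullary using (¬_; Dec; yes; no)
open import Relation.Nullary.Decidable using (toSum)
open import Relation.Binary.PropositionalEquality
  using (_≡_; _≢_; refl; sym; trans; cong; cong₂; subst; subst₂; module ≡-Reasoning)
open import Induction.WellFounded using (Acc; acc)

-- Substitution

infixl 5 _⊙_

_⊙_ : ∀ {k m n} → (Fin m → Tm n) → (Fin k → Tm m) → Fin k → Tm n
(σ ⊙ τ) i = subT σ (τ i)

subT-cong : ∀ {m n} {σ τ : Fin m → Tm n} → (∀ i → σ i ≡ τ i) → ∀ t → subT σ t ≡ subT τ t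
subT-cong e (var i) = e i
subT-cong e zer     = refl
subT-cong e (S t)   = cong S (subT-cong e t)
subT-cong e (s ⊕ t) = cong₂ _⊕_ (subT-cong e s) (subT-cong e t)
subT-cong e (s ⊗ t) = cong₂ _⊗_ (subT-cong e s) (subT-cong e t)

liftS-cong : ∀ {m n} {σ τ : Fin m → Tm n} → (∀ i → σ i ≡ τ i) → ∀ i → liftS σ i ≡ liftS τ i
liftS-cong e zero    = refl
liftS-cong e (suc i) = cong (renT suc) (e i)

sub-cong : ∀ {m n} {σ τ : Fin m → Tm n} → (∀ i → σ i ≡ τ i) → ∀ φ → sub σ φ ≡ sub τ φ
sub-cong e (eq s t)  = cong₂ eq (subT-cong e s) (subT-cong e t)
sub-cong e (neq s t) = cong₂ neq (subT-cong e s) (subT-cong e t)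
sub-cong e (le s t)  = cong₂ le (subT-cong e s) (subT-cong e t)
sub-cong e (nle s t) = cong₂ nle (subT-cong e s) (subT-cong e t)
sub-cong e (X t)     = cong X (subT-cong e t)
sub-cong e (nX t)    = cong nX (subT-cong e t)
sub-cong e (and φ ψ) = cong₂ and (sub-cong e φ) (sub-cong e ψ)
sub-cong e (or φ ψ)  = cong₂ or (sub-cong e φ) (sub-cong e ψ)
sub-cong e (all φ)   = cong all (sub-cong (liftS-cong e) φ)
sub-cong e (ex φ)    = cong ex (sub-cong (liftS-cong e) φ)

renT≗subT : ∀ {m n} (ρ : Fin m → Fin n) t → renT ρ t ≡ subT (var ∘ ρ) t
renT≗subT ρ (var i) = refl
renT≗subT ρ zer     = refl
renT≗subT ρ (S t)   = cong S (renT≗subT ρ t)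
renT≗subT ρ (s ⊕ t) = cong₂ _⊕_ (renT≗subT ρ s) (renT≗subT ρ t)
renT≗subT ρ (s ⊗ t) = cong₂ _⊗_ (renT≗subT ρ s) (renT≗subT ρ t)

liftR≗liftS : ∀ {m n} (ρ : Fin m → Fin n) i → var (liftR ρ i) ≡ liftS (var ∘ ρ) i
liftR≗liftS ρ zero    = refl
liftR≗liftS ρ (suc i) = refl

ren≗sub : ∀ {m n} (ρ : Fin m → Fin n) φ → ren ρ φ ≡ sub (var ∘ ρ) φ
ren≗sub ρ (eq s t)  = cong₂ eq (renT≗subT ρ s) (renT≗subT ρ t)
ren≗sub ρ (neq s t) = cong₂ neq (renT≗subT ρ s) (renT≗subT ρ t)
ren≗sub ρ (le s t)  = cong₂ le (renT≗subT ρ s) (renT≗subT ρ t)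
ren≗sub ρ (nle s t) = cong₂ nle (renT≗subT ρ s) (renT≗subT ρ t)
ren≗sub ρ (X t)     = cong X (renT≗subT ρ t)
ren≗sub ρ (nX t)    = cong nX (renT≗subT ρ t)
ren≗sub ρ (and φ ψ) = cong₂ and (ren≗sub ρ φ) (ren≗sub ρ ψ)
ren≗sub ρ (or φ ψ)  = cong₂ or (ren≗sub ρ φ) (ren≗sub ρ ψ)
ren≗sub ρ (all φ)   = cong all (trans (ren≗sub (liftR ρ) φ) (sub-cong (liftR≗liftS ρ) φ))
ren≗sub ρ (ex φ)    = cong ex (trans (ren≗sub (liftR ρ) φ) (sub-cong (liftR≗liftS ρ) φ))

subT-⊙ : ∀ {k m n} (σ : Fin m → Tm n) (τ : Fin k → Tm m) t → subT σ (subT τ t) ≡ subT (σ ⊙ τ) t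
subT-⊙ σ τ (var i) = refl
subT-⊙ σ τ zer     = refl
subT-⊙ σ τ (S t)   = cong S (subT-⊙ σ τ t)
subT-⊙ σ τ (s ⊕ t) = cong₂ _⊕_ (subT-⊙ σ τ s) (subT-⊙ σ τ t)
subT-⊙ σ τ (s ⊗ t) = cong₂ _⊗_ (subT-⊙ σ τ s) (subT-⊙ σ τ t)

subT-liftS-renT-suc : ∀ {m n} (σ : Fin m → Tm n) t → subT (liftS σ) (renT suc t) ≡ renT suc (subT σ t)
subT-liftS-renT-suc σ (var i) = refl
subT-liftS-renT-suc σ zer     = refl
subT-liftS-renT-suc σ (S t)   = cong S (subT-liftS-renT-suc σ t)
subT-liftS-renT-suc σ (s ⊕ t) = cong₂ _⊕_ (subT-liftS-renT-suc σ s) (subT-liftS-renT-suc σ t)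
subT-liftS-renT-suc σ (s ⊗ t) = cong₂ _⊗_ (subT-liftS-renT-suc σ s) (subT-liftS-renT-suc σ t)

liftS-⊙ : ∀ {k m n} (σ : Fin m → Tm n) (τ : Fin k → Tm m) i → (liftS σ ⊙ liftS τ) i ≡ liftS (σ ⊙ τ) i
liftS-⊙ σ τ zero    = refl
liftS-⊙ σ τ (suc i) = subT-liftS-renT-suc σ (τ i)

sub-⊙ : ∀ {k m n} (σ : Fin m → Tm n) (τ : Fin k → Tm m) φ → sub σ (sub τ φ) ≡ sub (σ ⊙ τ) φ
sub-⊙ σ τ (eq s t)  = cong₂ eq (subT-⊙ σ τ s) (subT-⊙ σ τ t)
sub-⊙ σ τ (neq s t) = cong₂ neq (subT-⊙ σ τ s) (subT-⊙ σ τ t)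
sub-⊙ σ τ (le s t)  = cong₂ le (subT-⊙ σ τ s) (subT-⊙ σ τ t)
sub-⊙ σ τ (nle s t) = cong₂ nle (subT-⊙ σ τ s) (subT-⊙ σ τ t)
sub-⊙ σ τ (X t)     = cong X (subT-⊙ σ τ t)
sub-⊙ σ τ (nX t)    = cong nX (subT-⊙ σ τ t)
sub-⊙ σ τ (and φ ψ) = cong₂ and (sub-⊙ σ τ φ) (sub-⊙ σ τ ψ)
sub-⊙ σ τ (or φ ψ)  = cong₂ or (sub-⊙ σ τ φ) (sub-⊙ σ τ ψ)
sub-⊙ σ τ (all φ)   = cong all (trans (sub-⊙ (liftS σ) (liftS τ) φ) (sub-cong (liftS-⊙ σ τ) φ))
sub-⊙ σ τ (ex φ)    = cong ex (trans (sub-⊙ (liftS σ) (liftS τ) φ) (sub-cong (liftS-⊙ σ τ) φ))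

subT-var : ∀ {n} (t : Tm n) → subT var t ≡ t
subT-var (var i) = refl
subT-var zer     = refl
subT-var (S t)   = cong S (subT-var t)
subT-var (s ⊕ t) = cong₂ _⊕_ (subT-var s) (subT-var t)
subT-var (s ⊗ t) = cong₂ _⊗_ (subT-var s) (subT-var t)

liftS-var : ∀ {n} (i : Fin (suc n)) → liftS var i ≡ var i
liftS-var zero    = refl
liftS-var (suc i) = refl

sub-var : ∀ {n} (φ : Fm n) → sub var φ ≡ φ
sub-var (eq s t)  = cong₂ eq (subT-var s) (subT-var t)
sub-var (neq s t) = cong₂ neq (subT-var s) (subT-var t)
sub-var (le s t)  = cong₂ le (subT-var s) (subT-var t)
sub-var (nle s t) = cong₂ nle (subT-var s) (subT-var t)
sub-var (X t)     = cong X (subT-var t)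
sub-var (nX t)    = cong nX (subT-var t)
sub-var (and φ ψ) = cong₂ and (sub-var φ) (sub-var ψ)
sub-var (or φ ψ)  = cong₂ or (sub-var φ) (sub-var ψ)
sub-var (all φ)   = cong all (trans (sub-cong liftS-var φ) (sub-var φ))
sub-var (ex φ)    = cong ex (trans (sub-cong liftS-var φ) (sub-var φ))

sub-closed : (σ : Fin 0 → Tm 0) (φ : Sentence) → sub σ φ ≡ φ
sub-closed σ φ = trans (sub-cong (λ ()) φ) (sub-var φ)

sub-neg : ∀ {m n} (σ : Fin m → Tm n) φ → sub σ (neg φ) ≡ neg (sub σ φ)
sub-neg σ (eq s t)  = refl
sub-neg σ (neq s t) = refl
sub-neg σ (le s t)  = refl
sub-neg σ (nle s t) = refl
sub-neg σ (X t)     = refl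
sub-neg σ (nX t)    = refl
sub-neg σ (and φ ψ) = cong₂ or (sub-neg σ φ) (sub-neg σ ψ)
sub-neg σ (or φ ψ)  = cong₂ and (sub-neg σ φ) (sub-neg σ ψ)
sub-neg σ (all φ)   = cong ex (sub-neg (liftS σ) φ)
sub-neg σ (ex φ)    = cong all (sub-neg (liftS σ) φ)

neg-involutive : ∀ {n} (φ : Fm n) → neg (neg φ) ≡ φ
neg-involutive (eq s t)  = refl
neg-involutive (neq s t) = refl
neg-involutive (le s t)  = refl
neg-involutive (nle s t) = refl
neg-involutive (X t)     = refl
neg-involutive (nX t)    = refl
neg-involutive (and φ ψ) = cong₂ and (neg-involutive φ) (neg-involutive ψ)
neg-involutive (or φ ψ)  = cong₂ or (neg-involutive φ) (neg-involutive ψ)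
neg-involutive (all φ)   = cong all (neg-involutive φ)
neg-involutive (ex φ)    = cong ex (neg-involutive φ)

rk-sub : ∀ {m n} (σ : Fin m → Tm n) φ → rk (sub σ φ) ≡ rk φ
rk-sub σ (eq s t)  = refl
rk-sub σ (neq s t) = refl
rk-sub σ (le s t)  = refl
rk-sub σ (nle s t) = refl
rk-sub σ (X t)     = refl
rk-sub σ (nX t)    = refl
rk-sub σ (and φ ψ) = cong₂ (λ a b → suc (a ⊔ b)) (rk-sub σ φ) (rk-sub σ ψ)
rk-sub σ (or φ ψ)  = cong₂ (λ a b → suc (a ⊔ b)) (rk-sub σ φ) (rk-sub σ ψ)
rk-sub σ (all φ)   = cong suc (rk-sub (liftS σ) φ)
rk-sub σ (ex φ)    = cong suc (rk-sub (liftS σ) φ)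

subT-inst-renT-suc : ∀ {n} (t : Tm n) u → subT (inst t) (renT suc u) ≡ u
subT-inst-renT-suc t u = begin
  subT (inst t) (renT suc u)     ≡⟨ cong (subT (inst t)) (renT≗subT suc u) ⟩
  subT (inst t) (subT (var ∘ suc) u) ≡⟨ subT-⊙ (inst t) (var ∘ suc) u ⟩
  subT var u                     ≡⟨ subT-var u ⟩
  u                              ∎
  where open ≡-Reasoning

extendS : ∀ {n} → Tm 0 → (Fin n → Tm 0) → Fin (suc n) → Tm 0
extendS t σ zero    = t
extendS t σ (suc i) = σ i

inst-liftS : ∀ {n} (t : Tm 0) (σ : Fin n → Tm 0) φ → (sub (liftS σ) φ) [ t ] ≡ sub (extendS t σ) φ
inst-liftS t σ φ = trans (sub-⊙ (inst t) (liftS σ) φ) (sub-cong pointwise φ)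
  where
  pointwise : ∀ i → (inst t ⊙ liftS σ) i ≡ extendS t σ i
  pointwise zero    = refl
  pointwise (suc i) = subT-inst-renT-suc t (σ i)

sub-extendS-wk : ∀ {n} (t : Tm 0) (σ : Fin n → Tm 0) φ → sub (extendS t σ) (wk φ) ≡ sub σ φ
sub-extendS-wk t σ φ = trans (cong (sub (extendS t σ)) (ren≗sub suc φ)) (sub-⊙ (extendS t σ) (var ∘ suc) φ)

inst-liftS-neg : ∀ {n} (t : Tm 0) (σ : Fin n → Tm 0) φ →
                 (neg (sub (liftS σ) φ)) [ t ] ≡ neg (sub (extendS t σ) φ)
inst-liftS-neg t σ φ = trans (sub-neg (inst t) (sub (liftS σ) φ)) (cong neg (inst-liftS t σ φ))

sub-inst : ∀ {m n} (σ : Fin m → Tm n) (t : Tm m) φ → sub σ (φ [ t ]) ≡ (sub (liftS σ) φ) [ subT σ t ]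
sub-inst σ t φ =
  trans (sub-⊙ σ (inst t) φ) (trans (sub-cong pointwise φ) (sym (sub-⊙ (inst (subT σ t)) (liftS σ) φ)))
  where
  pointwise : ∀ i → (σ ⊙ inst t) i ≡ (inst (subT σ t) ⊙ liftS σ) i
  pointwise zero    = refl
  pointwise (suc i) = sym (subT-inst-renT-suc (subT σ t) (σ i))

map-sub-extendS-wk : ∀ {n} t (σ : Fin n → Tm 0) Γ → map (sub (extendS t σ)) (map wk Γ) ≡ map (sub σ) Γ
map-sub-extendS-wk t σ []      = refl
map-sub-extendS-wk t σ (A ∷ Γ) = cong₂ _∷_ (sub-extendS-wk t σ A) (map-sub-extendS-wk t σ Γ)

map-sub-closed : (σ : Fin 0 → Tm 0) (Γ : Sequent) → map (sub σ) Γ ≡ Γ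
map-sub-closed σ []      = refl
map-sub-closed σ (A ∷ Γ) = cong₂ _∷_ (sub-closed σ A) (map-sub-closed σ Γ)

subT-stepSub-renT-suc : ∀ {k} (u : Tm k) → subT stepSub (renT suc u) ≡ renT suc u
subT-stepSub-renT-suc u =
  trans (cong (subT stepSub) (renT≗subT suc u)) (trans (subT-⊙ stepSub (var ∘ suc) u) (sym (renT≗subT suc u)))

sub-liftS-stepSub : ∀ {k n} (σ : Fin k → Tm n) (φ : Fm (suc k)) →
                    sub (liftS σ) (sub stepSub φ) ≡ sub stepSub (sub (liftS σ) φ)
sub-liftS-stepSub σ φ =
  trans (sub-⊙ (liftS σ) stepSub φ) (trans (sub-cong pointwise φ) (sym (sub-⊙ stepSub (liftS σ) φ)))
  where
  pointwise : ∀ i → (liftS σ ⊙ stepSub) i ≡ (stepSub ⊙ liftS σ) i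
  pointwise zero    = refl
  pointwise (suc i) = sym (subT-stepSub-renT-suc (σ i))

sub-IndBody : ∀ {k n} (σ : Fin k → Tm n) (φ : Fm (suc k)) → sub σ (IndBody φ) ≡ IndBody (sub (liftS σ) φ)
sub-IndBody σ φ = cong (λ A → or A (all (sub (liftS σ) φ)))
  (trans (sub-neg σ _) (cong neg (cong₂ and (sub-inst σ zer φ)
                                            (cong all (cong₂ or (sub-neg (liftS σ) φ) (sub-liftS-stepSub σ φ))))))

-- The standard model

evalT-cong : ∀ {n} {ρ ρ' : Fin n → ℕ} → (∀ i → ρ i ≡ ρ' i) → ∀ t → evalT ρ t ≡ evalT ρ' t
evalT-cong e (var i) = e i
evalT-cong e zer     = refl
evalT-cong e (S t)   = cong suc (evalT-cong e t)
evalT-cong e (s ⊕ t) = cong₂ _+_ (evalT-cong e s) (evalT-cong e t)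
evalT-cong e (s ⊗ t) = cong₂ _*_ (evalT-cong e s) (evalT-cong e t)

evalT-subT : ∀ {m n} (ρ : Fin n → ℕ) (σ : Fin m → Tm n) t → evalT ρ (subT σ t) ≡ evalT (evalT ρ ∘ σ) t
evalT-subT ρ σ (var i) = refl
evalT-subT ρ σ zer     = refl
evalT-subT ρ σ (S t)   = cong suc (evalT-subT ρ σ t)
evalT-subT ρ σ (s ⊕ t) = cong₂ _+_ (evalT-subT ρ σ s) (evalT-subT ρ σ t)
evalT-subT ρ σ (s ⊗ t) = cong₂ _*_ (evalT-subT ρ σ s) (evalT-subT ρ σ t)

evalT-renT-suc : ∀ {n} m (ρ : Fin n → ℕ) t → evalT (extend m ρ) (renT suc t) ≡ evalT ρ t
evalT-renT-suc m ρ t =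
  trans (cong (evalT (extend m ρ)) (renT≗subT suc t)) (evalT-subT (extend m ρ) (var ∘ suc) t)

val-subT : ∀ {n} (σ : Fin n → Tm 0) t → val (subT σ t) ≡ evalT (val ∘ σ) t
val-subT σ = evalT-subT _ σ

evalT-closed : (ρ : Fin 0 → ℕ) (t : Tm 0) → evalT ρ t ≡ val t
evalT-closed ρ = evalT-cong (λ ())

evalT-liftS : ∀ {m n} k (ρ : Fin n → ℕ) (σ : Fin m → Tm n) i →
              evalT (extend k ρ) (liftS σ i) ≡ extend k (evalT ρ ∘ σ) i
evalT-liftS k ρ σ zero    = refl
evalT-liftS k ρ σ (suc i) = evalT-renT-suc k ρ (σ i)

extend-cong : ∀ {n} m {ρ ρ' : Fin n → ℕ} → (∀ i → ρ i ≡ ρ' i) → ∀ i → extend m ρ i ≡ extend m ρ' i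
extend-cong m e zero    = refl
extend-cong m e (suc i) = e i

Sat-cong : ∀ {n} {P : ℕ → Set} {ρ ρ' : Fin n → ℕ} → (∀ i → ρ i ≡ ρ' i) → ∀ φ → Sat P ρ φ → Sat P ρ' φ
Sat-cong e (eq s t)  h    = trans (sym (evalT-cong e s)) (trans h (evalT-cong e t))
Sat-cong e (neq s t) h h' = h (trans (evalT-cong e s) (trans h' (sym (evalT-cong e t))))
Sat-cong e (le s t)  h    = subst₂ _≤_ (evalT-cong e s) (evalT-cong e t) h
Sat-cong e (nle s t) h h' = h (subst₂ _≤_ (sym (evalT-cong e s)) (sym (evalT-cong e t)) h')
Sat-cong {P = P} e (X t)  h    = subst P (evalT-cong e t) h
Sat-cong {P = P} e (nX t) h h' = h (subst P (sym (evalT-cong e t)) h')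
Sat-cong e (and φ ψ) (a , b) = Sat-cong e φ a , Sat-cong e ψ b
Sat-cong e (or φ ψ) (inj₁ a) = inj₁ (Sat-cong e φ a)
Sat-cong e (or φ ψ) (inj₂ b) = inj₂ (Sat-cong e ψ b)
Sat-cong e (all φ) h m       = Sat-cong (extend-cong m e) φ (h m)
Sat-cong e (ex φ) (m , h)    = m , Sat-cong (extend-cong m e) φ h

Sat-sub : ∀ {m n} {P : ℕ → Set} (ρ : Fin n → ℕ) (σ : Fin m → Tm n) φ →
          Sat P ρ (sub σ φ) → Sat P (evalT ρ ∘ σ) φ
Sat-sub ρ σ (eq s t)  h    = trans (sym (evalT-subT ρ σ s)) (trans h (evalT-subT ρ σ t))
Sat-sub ρ σ (neq s t) h h' = h (trans (evalT-subT ρ σ s) (trans h' (sym (evalT-subT ρ σ t))))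
Sat-sub ρ σ (le s t)  h    = subst₂ _≤_ (evalT-subT ρ σ s) (evalT-subT ρ σ t) h
Sat-sub ρ σ (nle s t) h h' = h (subst₂ _≤_ (sym (evalT-subT ρ σ s)) (sym (evalT-subT ρ σ t)) h')
Sat-sub {P = P} ρ σ (X t)  h    = subst P (evalT-subT ρ σ t) h
Sat-sub {P = P} ρ σ (nX t) h h' = h (subst P (sym (evalT-subT ρ σ t)) h')
Sat-sub ρ σ (and φ ψ) (a , b) = Sat-sub ρ σ φ a , Sat-sub ρ σ ψ b
Sat-sub ρ σ (or φ ψ) (inj₁ a) = inj₁ (Sat-sub ρ σ φ a)
Sat-sub ρ σ (or φ ψ) (inj₂ b) = inj₂ (Sat-sub ρ σ ψ b)
Sat-sub ρ σ (all φ) h k       = Sat-cong (evalT-liftS k ρ σ) φ (Sat-sub (extend k ρ) (liftS σ) φ (h k))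
Sat-sub ρ σ (ex φ) (k , h)    = k , Sat-cong (evalT-liftS k ρ σ) φ (Sat-sub (extend k ρ) (liftS σ) φ h)

Sat-inst : ∀ {P : ℕ → Set} (ρ ρ' : Fin 0 → ℕ) (φ : Fm 1) t → Sat P ρ (φ [ t ]) → Sat P (extend (val t) ρ') φ
Sat-inst ρ ρ' φ t h = Sat-cong pointwise φ (Sat-sub ρ (inst t) φ h)
  where
  pointwise : ∀ i → evalT ρ (inst t i) ≡ extend (val t) ρ' i
  pointwise zero = evalT-closed ρ t

XPositive : ∀ {n} → Fm n → Set
XPositive (nX _)    = ⊥
XPositive (and φ ψ) = XPositive φ × XPositive ψ
XPositive (or φ ψ)  = XPositive φ × XPositive ψ
XPositive (all φ)   = XPositive φ
XPositive (ex φ)    = XPositive φ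
XPositive _         = ⊤

XPositive-sub : ∀ {m n} (σ : Fin m → Tm n) φ → XPositive φ → XPositive (sub σ φ)
XPositive-sub σ (eq s t)  p       = tt
XPositive-sub σ (neq s t) p       = tt
XPositive-sub σ (le s t)  p       = tt
XPositive-sub σ (nle s t) p       = tt
XPositive-sub σ (X t)     p       = tt
XPositive-sub σ (and φ ψ) (p , q) = XPositive-sub σ φ p , XPositive-sub σ ψ q
XPositive-sub σ (or φ ψ)  (p , q) = XPositive-sub σ φ p , XPositive-sub σ ψ q
XPositive-sub σ (all φ)   p       = XPositive-sub (liftS σ) φ p
XPositive-sub σ (ex φ)    p       = XPositive-sub (liftS σ) φ p

Sat-mono : ∀ {n} {P Q : ℕ → Set} {ρ : Fin n → ℕ} φ → XPositive φ → (∀ k → P k → Q k) → Sat P ρ φ → Sat Q ρ φ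
Sat-mono (eq s t)  _ f h = h
Sat-mono (neq s t) _ f h = h
Sat-mono (le s t)  _ f h = h
Sat-mono (nle s t) _ f h = h
Sat-mono (X t)     _ f h = f _ h
Sat-mono (and φ ψ) (p , q) f (a , b) = Sat-mono φ p f a , Sat-mono ψ q f b
Sat-mono (or φ ψ) (p , q) f (inj₁ a) = inj₁ (Sat-mono φ p f a)
Sat-mono (or φ ψ) (p , q) f (inj₂ b) = inj₂ (Sat-mono ψ q f b)
Sat-mono (all φ) p f h m             = Sat-mono φ p f (h m)
Sat-mono (ex φ) p f (m , h)          = m , Sat-mono φ p f h

TrueLit⇒Sat : ∀ {P : ℕ → Set} (ρ : Fin 0 → ℕ) l → TrueLit l → Sat P ρ l
TrueLit⇒Sat ρ (eq s t)  h   = trans (evalT-closed ρ s) (trans h (sym (evalT-closed ρ t)))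
TrueLit⇒Sat ρ (neq s t) h e = h (trans (sym (evalT-closed ρ s)) (trans e (evalT-closed ρ t)))
TrueLit⇒Sat ρ (le s t)  h   = subst₂ _≤_ (sym (evalT-closed ρ s)) (sym (evalT-closed ρ t)) h
TrueLit⇒Sat ρ (nle s t) h e = h (subst₂ _≤_ (evalT-closed ρ s) (evalT-closed ρ t) e)

num : ℕ → Tm 0
num zero    = zer
num (suc n) = S (num n)

val-num : ∀ n → val (num n) ≡ n
val-num zero    = refl
val-num (suc n) = cong suc (val-num n)

decide : ∀ {A : Set} → Dec A → ¬ A ⊎ A
decide = swap ∘ toSum

unlessEqual₂ : ∀ {C : Set} (x y z w : ℕ) → (x ≡ y → z ≡ w → C) → (x ≢ y ⊎ z ≢ w) ⊎ C
unlessEqual₂ x y z w f with x ≟ y | z ≟ w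
... | no x≢y  | _        = inj₁ (inj₁ x≢y)
... | yes _   | no z≢w   = inj₁ (inj₂ z≢w)
... | yes x≡y | yes z≡w  = inj₂ (f x≡y z≡w)

_≈ᵛ_ : ∀ {n} → (σ τ : Fin n → Tm 0) → Set
σ ≈ᵛ τ = ∀ i → val (σ i) ≡ val (τ i)

val-subT-≈ᵛ : ∀ {n} {σ τ : Fin n → Tm 0} → σ ≈ᵛ τ → ∀ u → val (subT σ u) ≡ val (subT τ u)
val-subT-≈ᵛ {σ = σ} {τ} e u = trans (val-subT σ u) (trans (evalT-cong e u) (sym (val-subT τ u)))

extendS-≈ᵛ : ∀ {n} t {σ τ : Fin n → Tm 0} → σ ≈ᵛ τ → extendS t σ ≈ᵛ extendS t τ
extendS-≈ᵛ t e zero    = refl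
extendS-≈ᵛ t e (suc i) = e i

extend-val : ∀ {n} t (σ : Fin n → Tm 0) i → extend (val t) (val ∘ σ) i ≡ val (extendS t σ i)
extend-val t σ zero    = refl
extend-val t σ (suc i) = refl

-- Well orders

module WellOrder {A : Set} {_≺_ : A → A → Set} (wo : IsWellOrder _≺_) where
  open IsWellOrder wo renaming (trans to ≺-trans)

  _≼_ : A → A → Set
  a ≼ b = a ≺ b ⊎ a ≡ b

  ≼-≺-trans : ∀ {a b c} → a ≼ b → b ≺ c → a ≺ c
  ≼-≺-trans (inj₁ a≺b)  b≺c = ≺-trans a≺b b≺c
  ≼-≺-trans (inj₂ refl) b≺c = b≺c

  upperBound : (a b : A) → Σ A λ c → a ≼ c × b ≼ c
  upperBound a b with tri a b
  ... | inj₁ a≺b        = b , inj₁ a≺b , inj₂ refl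
  ... | inj₂ (inj₁ refl) = a , inj₂ refl , inj₂ refl
  ... | inj₂ (inj₂ b≺a) = a , inj₂ refl , inj₁ b≺a

  selfEmbedding-noShrink : (h : A → A) → (∀ a b → a ≺ b → h a ≺ h b) → ∀ a → ¬ (h a ≺ a)
  selfEmbedding-noShrink h mono a = go a (wf a)
    where
    go : ∀ a → Acc _≺_ a → ¬ (h a ≺ a)
    go a (acc rs) ha≺a = go (h a) (rs ha≺a) (mono (h a) a ha≺a)

  module _ (lem : ExcludedMiddle 0ℓ) (P : A → Set) where

    minimal : ∀ {b} → P b → Σ A λ a → P a × a ≼ b × (∀ c → c ≺ a → ¬ P c)
    minimal {b} pb = go b (wf b) pb
      where
      go : ∀ b → Acc _≺_ b → P b → Σ A λ a → P a × a ≼ b × (∀ c → c ≺ a → ¬ P c)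
      go b (acc rs) pb with lem {Σ A λ c → c ≺ b × P c}
      ... | yes (c , c≺b , pc) = let a , pa , a≼c , min = go c (rs c≺b) pc
                                 in a , pa , inj₁ (≼-≺-trans a≼c c≺b) , min
      ... | no ∄c              = b , pb , inj₂ refl , λ c c≺b pc → ∄c (c , c≺b , pc)

-- The infinitary system

∈-≡ : ∀ {A : Set} {x y : A} {xs} → x ≡ y → x ∈ xs → y ∈ xs
∈-≡ refl m = m

∈₀ : ∀ {A : Set} {x : A} {xs} → x ∈ x ∷ xs
∈₀ = here refl

∈₁ : ∀ {A : Set} {x y : A} {xs} → x ∈ y ∷ x ∷ xs
∈₁ = there ∈₀

module Derivations (O : OrdStruct) (lt : Fm 2) where
  open OrdStruct O
  open Infinitary O lt
  open WellOrder isWO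

  fin : ℕ → E
  fin zero    = o0
  fin (suc n) = fin n +1

  fin≺ω : ∀ n → fin n ≺ ω
  fin≺ω zero    = o0≺ω
  fin≺ω (suc n) = ω-closed (fin≺ω n)

  premise₀ : ∀ {α d Γ} → Der α 0 Γ → Prem (α +1) d Γ
  premise₀ D = prem _ 0 _ (<+1 _) z≤n id D

  premise : ∀ {α d Γ} → Der α d Γ → Prem (α +1) d Γ
  premise D = prem _ _ _ (<+1 _) ≤-refl id D

  literal-identity : ∀ {n α d Γ} (A : Fm n) → IsLiteral A → {σ τ : Fin n → Tm 0} → σ ≈ᵛ τ →
                     neg (sub σ A) ∈ Γ → sub τ A ∈ Γ → Der α d Γ
  literal-identity (eq s t) _ {τ = τ} e mσ mτ with val (subT τ s) ≟ val (subT τ t)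
  ... | yes p = axLit _ mτ p
  ... | no ¬p = axLit _ mσ λ q → ¬p (trans (sym (val-subT-≈ᵛ e s)) (trans q (val-subT-≈ᵛ e t)))
  literal-identity (neq s t) _ {σ} e mσ mτ with val (subT σ s) ≟ val (subT σ t)
  ... | yes p = axLit _ mσ p
  ... | no ¬p = axLit _ mτ λ q → ¬p (trans (val-subT-≈ᵛ e s) (trans q (sym (val-subT-≈ᵛ e t))))
  literal-identity (le s t) _ {τ = τ} e mσ mτ with val (subT τ s) ≤? val (subT τ t)
  ... | yes p = axLit _ mτ p
  ... | no ¬p = axLit _ mσ λ q → ¬p (subst₂ _≤_ (val-subT-≈ᵛ e s) (val-subT-≈ᵛ e t) q)
  literal-identity (nle s t) _ {σ} e mσ mτ with val (subT σ s) ≤? val (subT σ t)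
  ... | yes p = axLit _ mσ p
  ... | no ¬p = axLit _ mτ λ q → ¬p (subst₂ _≤_ (sym (val-subT-≈ᵛ e s)) (sym (val-subT-≈ᵛ e t)) q)
  literal-identity (X t)  _ {σ} {τ} e mσ mτ = axX (subT τ t) (subT σ t) mτ mσ (sym (val-subT-≈ᵛ e t))
  literal-identity (nX t) _ {σ} {τ} e mσ mτ = axX (subT σ t) (subT τ t) mσ mτ (val-subT-≈ᵛ e t)

  identityHeight : ∀ {n} → Fm n → ℕ
  identityHeight (and φ ψ) = suc (suc (identityHeight φ ⊔ identityHeight ψ))
  identityHeight (or φ ψ)  = suc (suc (identityHeight φ ⊔ identityHeight ψ))
  identityHeight (all φ)   = suc (suc (identityHeight φ))
  identityHeight (ex φ)    = suc (suc (identityHeight φ))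
  identityHeight _         = 0

  identity : ∀ {n Γ} (φ : Fm n) {σ τ : Fin n → Tm 0} → σ ≈ᵛ τ → ∀ k → identityHeight φ ≤ k →
             neg (sub σ φ) ∈ Γ → sub τ φ ∈ Γ → Der (fin k) 0 Γ
  identity φ@(eq _ _)  e _ _ = literal-identity φ tt e
  identity φ@(neq _ _) e _ _ = literal-identity φ tt e
  identity φ@(le _ _)  e _ _ = literal-identity φ tt e
  identity φ@(nle _ _) e _ _ = literal-identity φ tt e
  identity φ@(X _)     e _ _ = literal-identity φ tt e
  identity φ@(nX _)    e _ _ = literal-identity φ tt e
  identity (and a b) e (suc (suc j)) (s≤s (s≤s h)) mσ mτ =
    ∧I _ _ mτ
      (premise₀ (∨I _ _ (there mσ) false (premise₀ (identity a e j (m⊔n≤o⇒m≤o _ _ h) ∈₀ ∈₁))))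
      (premise₀ (∨I _ _ (there mσ) true  (premise₀ (identity b e j (m⊔n≤o⇒n≤o _ _ h) ∈₀ ∈₁))))
  identity (or a b) e (suc (suc j)) (s≤s (s≤s h)) mσ mτ =
    ∧I _ _ mσ
      (premise₀ (∨I _ _ (there mτ) false (premise₀ (identity a e j (m⊔n≤o⇒m≤o _ _ h) ∈₁ ∈₀))))
      (premise₀ (∨I _ _ (there mτ) true  (premise₀ (identity b e j (m⊔n≤o⇒n≤o _ _ h) ∈₁ ∈₀))))
  identity (all φ) {σ} {τ} e (suc (suc j)) (s≤s (s≤s h)) mσ mτ =
    ∀I _ mτ λ t → premise₀ (∃I _ (there mσ) t (premise₀
      (identity φ (extendS-≈ᵛ t e) j h (∈-≡ (inst-liftS-neg t σ φ) ∈₀) (∈-≡ (inst-liftS t τ φ) ∈₁))))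
  identity (ex φ) {σ} {τ} e (suc (suc j)) (s≤s (s≤s h)) mσ mτ =
    ∀I _ mσ λ t → premise₀ (∃I _ (there mτ) t (premise₀
      (identity φ (extendS-≈ᵛ t e) j h (∈-≡ (inst-liftS-neg t σ φ) ∈₁) (∈-≡ (inst-liftS t τ φ) ∈₀))))

  truth : ∀ {n Γ} {Q : ℕ → Set} (φ : Fm n) → IsPA φ → (σ : Fin n → Tm 0) → Sat Q (val ∘ σ) φ →
          ∀ k → rk φ ≤ k → sub σ φ ∈ Γ → Der (fin k) 0 Γ
  truth (eq s t)  _ σ h _ _ m = axLit _ m (trans (val-subT σ s) (trans h (sym (val-subT σ t))))
  truth (neq s t) _ σ h _ _ m = axLit _ m λ q → h (trans (sym (val-subT σ s)) (trans q (val-subT σ t)))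
  truth (le s t)  _ σ h _ _ m = axLit _ m (subst₂ _≤_ (sym (val-subT σ s)) (sym (val-subT σ t)) h)
  truth (nle s t) _ σ h _ _ m = axLit _ m λ q → h (subst₂ _≤_ (val-subT σ s) (val-subT σ t) q)
  truth (and a b) (pa , pb) σ (ha , hb) (suc j) (s≤s r) m =
    ∧I _ _ m (premise₀ (truth a pa σ ha j (m⊔n≤o⇒m≤o _ _ r) ∈₀))
             (premise₀ (truth b pb σ hb j (m⊔n≤o⇒n≤o _ _ r) ∈₀))
  truth (or a b) (pa , pb) σ (inj₁ ha) (suc j) (s≤s r) m =
    ∨I _ _ m false (premise₀ (truth a pa σ ha j (m⊔n≤o⇒m≤o _ _ r) ∈₀))
  truth (or a b) (pa , pb) σ (inj₂ hb) (suc j) (s≤s r) m =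
    ∨I _ _ m true (premise₀ (truth b pb σ hb j (m⊔n≤o⇒n≤o _ _ r) ∈₀))
  truth (all φ) p σ h (suc j) (s≤s r) m = ∀I _ m λ t →
    premise₀ (truth φ p (extendS t σ) (Sat-cong (extend-val t σ) φ (h (val t))) j r
                    (∈-≡ (inst-liftS t σ φ) ∈₀))
  truth {Q = Q} (ex φ) p σ (v , h) (suc j) (s≤s r) m = ∃I _ m (num v)
    (premise₀ (truth φ p (extendS (num v) σ) (Sat-cong (extend-val (num v) σ) φ h′) j r
                     (∈-≡ (inst-liftS (num v) σ φ) ∈₀)))
    where
    h′ : Sat Q (extend (val (num v)) (val ∘ σ)) φ
    h′ = subst (λ n → Sat Q (extend n (val ∘ σ)) φ) (sym (val-num v)) h

  Derivable : Sequent → Set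
  Derivable Γ = Σ E λ α → Σ ℕ λ d → Der α d Γ

  module _ (ψ : Fm 1) where

    chainHeight : ℕ → ℕ
    chainHeight zero    = identityHeight ψ
    chainHeight (suc n) = suc (suc (chainHeight n))

    identityHeight≤chainHeight : ∀ n → identityHeight ψ ≤ chainHeight n
    identityHeight≤chainHeight zero    = ≤-refl
    identityHeight≤chainHeight (suc n) = m≤n⇒m≤1+n (m≤n⇒m≤1+n (identityHeight≤chainHeight n))

    induction-chain : ∀ {Γ} n (t : Tm 0) → val t ≡ n →
                      neg (ψ [ zer ]) ∈ Γ → ex (neg (ψ ⇒ sub stepSub ψ)) ∈ Γ → ψ [ t ] ∈ Γ →
                      Der (fin (chainHeight n)) 0 Γ
    induction-chain zero t t≡0 m₀ mₛ mₜ =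
      identity ψ (λ { zero → sym t≡0 }) (identityHeight ψ) ≤-refl m₀ mₜ
    induction-chain (suc n) t t≡1+n m₀ mₛ mₜ =
      ∃I _ mₛ (num n) (premise₀ (∧I _ _ ∈₀
        (premise₀ (induction-chain n (num n) (val-num n) (there (there m₀)) (there (there mₛ))
                     (∈-≡ (cong (sub (inst (num n))) (neg-involutive ψ)) ∈₀)))
        (premise₀ (identity ψ {inst (num n) ⊙ stepSub} (λ { zero → trans (cong suc (val-num n)) (sym t≡1+n) })
                     (chainHeight n) (identityHeight≤chainHeight n) (∈-≡ neg-step ∈₀) (there (there mₜ))))))
      where
      neg-step : neg (sub stepSub ψ) [ num n ] ≡ neg (sub (inst (num n) ⊙ stepSub) ψ)
      neg-step = trans (sub-neg (inst (num n)) (sub stepSub ψ)) (cong neg (sub-⊙ (inst (num n)) stepSub ψ))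

    -- The instances ψ(t) have derivations of unbounded finite height, so ∀x ψ costs ω.
    induction-instance : Der (ω +1 +1 +1 +1) 0 (IndBody ψ ∷ [])
    induction-instance =
      ∨I _ _ ∈₀ false (premise₀ (∨I _ _ (there ∈₀) true (premise₀ (∨I _ _ ∈₁ false (premise₀
        (∨I _ _ (there (there ∈₀)) true (premise₀
          (∀I _ (there (there ∈₀)) λ t →
            prem _ 0 _ (fin≺ω (chainHeight (val t))) z≤n id
                 (induction-chain (val t) t refl (there ∈₁) ∈₁ ∈₀)))))))))

  closeAll-intro : ∀ k (ψ : Fm k) β → (∀ (σ : Fin k → Tm 0) → Der β 0 (sub σ ψ ∷ [])) →
                   Derivable (closeAll k ψ ∷ [])
  closeAll-intro zero    ψ β D = β , 0 , subst (λ A → Der β 0 (A ∷ [])) (sub-closed _ ψ) (D (λ ()))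
  closeAll-intro (suc k) ψ β D = closeAll-intro k (all ψ) (β +1) λ σ → ∀I _ ∈₀ λ t →
    prem β 0 _ (<+1 β) z≤n (λ { (here refl) → ∈-≡ (inst-liftS t σ ψ) (∈₀ {xs = sub σ (all ψ) ∷ []}) })
         (D (extendS t σ))

  true-axiom : (A : Sentence) → IsPA A → (∀ ρ → Sat (λ _ → ⊥) ρ A) → Derivable (A ∷ [])
  true-axiom A pa h = fin (rk A) , 0 , truth A pa (λ ()) (h _) (rk A) ≤-refl (∈-≡ (sym (sub-closed _ A)) ∈₀)

  eqX-derivable : Derivable (closeAll 2 (eq v0 v1 ⇒ (X v0 ⇒ X v1)) ∷ [])
  eqX-derivable = closeAll-intro 2 _ (fin 4) λ σ →
    ∨I _ _ ∈₀ false (premise₀ (∨I _ _ ∈₁ true (premise₀ (∨I _ _ ∈₀ false (premise₀ (∨I _ _ ∈₁ true (premise₀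
      (X-congruence (σ zero) (σ (suc zero)) ∈₀ ∈₁ (there (there (there ∈₀)))))))))))
    where
    X-congruence : ∀ {Γ} a b → X b ∈ Γ → nX a ∈ Γ → neq a b ∈ Γ → Der (fin 0) 0 Γ
    X-congruence a b mb ma mneq with val a ≟ val b
    ... | yes a≡b = axX b a mb ma (sym a≡b)
    ... | no a≢b  = axLit (neq a b) mneq a≢b

  axiom-derivable : ∀ {A} → AxiomPAX A → Derivable (A ∷ [])
  axiom-derivable eqRefl  = true-axiom _ _ λ _ m → refl
  axiom-derivable eqS     = true-axiom _ _ λ _ a b → Sum.map₂ (cong suc) (decide (b ≟ a))
  axiom-derivable eqPlus  = true-axiom _ _ λ _ a b c d → unlessEqual₂ d c b a (cong₂ _+_)
  axiom-derivable eqTimes = true-axiom _ _ λ _ a b c d → unlessEqual₂ d c b a (cong₂ _*_)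
  axiom-derivable eqEq    = true-axiom _ _ λ _ a b c d → unlessEqual₂ d c b a λ { refl refl → decide (d ≟ b) }
  axiom-derivable eqLe    = true-axiom _ _ λ _ a b c d → unlessEqual₂ d c b a λ { refl refl → decide (d ≤? b) }
  axiom-derivable eqX     = eqX-derivable
  axiom-derivable Q1      = true-axiom _ _ λ _ m ()
  axiom-derivable Q2      = true-axiom _ _ λ _ a b → Sum.map₁ (_∘ suc-injective) (decide (b ≟ a))
  axiom-derivable Q3      = true-axiom _ _ λ { _ zero → inj₁ refl ; _ (suc k) → inj₂ (k , refl) }
  axiom-derivable Q4      = true-axiom _ _ λ _ m → +-identityʳ m
  axiom-derivable Q5      = true-axiom _ _ λ _ a b → +-suc b a
  axiom-derivable Q6      = true-axiom _ _ λ _ m → *-zeroʳ m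
  axiom-derivable Q7      = true-axiom _ _ λ _ a b → trans (*-suc b a) (+-comm b (b * a))
  axiom-derivable Q8      = true-axiom _ _ λ _ a b → ≤⇒difference b a , difference⇒≤ b a
    where
    ≤⇒difference : ∀ x y → ¬ (x ≤ y) ⊎ Σ ℕ λ z → x + z ≡ y
    ≤⇒difference x y = Sum.map₂ (λ x≤y → y ∸ x , m+[n∸m]≡n x≤y) (decide (x ≤? y))
    difference⇒≤ : ∀ x y → (∀ z → x + z ≢ y) ⊎ x ≤ y
    difference⇒≤ x y = Sum.map₁ (λ x≰y z e → x≰y (subst (x ≤_) e (m≤m+n x z))) (decide (x ≤? y))
  axiom-derivable (ind k φ) = closeAll-intro k (IndBody φ) (ω +1 +1 +1 +1) λ σ →
    subst (λ A → Der (ω +1 +1 +1 +1) 0 (A ∷ [])) (sym (sub-IndBody σ φ)) (induction-instance (sub (liftS σ) φ))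

  height : ∀ {n Γ} → Tait n Γ → ℕ
  height (ax _ _ _ _)     = 0
  height (andR _ _ _ p q) = suc (height p ⊔ height q)
  height (orR₀ _ _ _ p)   = suc (height p)
  height (orR₁ _ _ _ p)   = suc (height p)
  height (allR _ _ p)     = suc (height p)
  height (exR _ _ _ p)    = suc (height p)
  height (cutR _ p q)     = suc (height p ⊔ height q)

  cutRank : ∀ {n Γ} → Tait n Γ → ℕ
  cutRank (ax _ _ _ _)     = 0
  cutRank (andR _ _ _ p q) = cutRank p ⊔ cutRank q
  cutRank (orR₀ _ _ _ p)   = cutRank p
  cutRank (orR₁ _ _ _ p)   = cutRank p
  cutRank (allR _ _ p)     = cutRank p
  cutRank (exR _ _ _ p)    = cutRank p
  cutRank (cutR A p q)     = suc (rk A) ⊔ (cutRank p ⊔ cutRank q)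

  embed-Tait : ∀ {n Γ} (π : Tait n Γ) (σ : Fin n → Tm 0) k d → height π ≤ k → cutRank π ≤ d →
               Der (fin k) d (map (sub σ) Γ)
  embed-Tait (ax A lit m mn) σ k d _ _ =
    literal-identity A lit {σ} {σ} (λ _ → refl) (∈-≡ (sub-neg σ A) (∈-map⁺ (sub σ) mn)) (∈-map⁺ (sub σ) m)
  embed-Tait (andR A B m p q) σ (suc k) d (s≤s h) c =
    ∧I _ _ (∈-map⁺ (sub σ) m) (premise (embed-Tait p σ k d (m⊔n≤o⇒m≤o (height p) _ h) (m⊔n≤o⇒m≤o (cutRank p) _ c)))
                              (premise (embed-Tait q σ k d (m⊔n≤o⇒n≤o (height p) _ h) (m⊔n≤o⇒n≤o (cutRank p) _ c)))
  embed-Tait (orR₀ A B m p) σ (suc k) d (s≤s h) c = ∨I _ _ (∈-map⁺ (sub σ) m) false (premise (embed-Tait p σ k d h c))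
  embed-Tait (orR₁ A B m p) σ (suc k) d (s≤s h) c = ∨I _ _ (∈-map⁺ (sub σ) m) true (premise (embed-Tait p σ k d h c))
  embed-Tait {Γ = Γ} (allR A m p) σ (suc k) d (s≤s h) c = ∀I _ (∈-map⁺ (sub σ) m) λ t →
    premise (subst (Der (fin k) d) (cong₂ _∷_ (sym (inst-liftS t σ A)) (map-sub-extendS-wk t σ Γ))
                   (embed-Tait p (extendS t σ) k d h c))
  embed-Tait {Γ = Γ} (exR A m t p) σ (suc k) d (s≤s h) c = ∃I _ (∈-map⁺ (sub σ) m) (subT σ t)
    (premise (subst (λ B → Der (fin k) d (B ∷ map (sub σ) Γ)) (sub-inst σ t A) (embed-Tait p σ k d h c)))
  embed-Tait {Γ = Γ} (cutR A p q) σ (suc k) d (s≤s h) c =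
    cut (sub σ A) (subst (λ r → suc r ≤ d) (sym (rk-sub σ A)) (m⊔n≤o⇒m≤o (suc (rk A)) (cutRank p ⊔ cutRank q) c))
      (premise (embed-Tait p σ k d (m⊔n≤o⇒m≤o (height p) _ h) (m⊔n≤o⇒m≤o (cutRank p) _ c′)))
      (premise (subst (λ B → Der (fin k) d (B ∷ map (sub σ) Γ)) (sub-neg σ A)
                      (embed-Tait q σ k d (m⊔n≤o⇒n≤o (height p) _ h) (m⊔n≤o⇒n≤o (cutRank p) _ c′))))
    where
    c′ : cutRank p ⊔ cutRank q ≤ d
    c′ = m⊔n≤o⇒n≤o (suc (rk A)) (cutRank p ⊔ cutRank q) c

  cut-with : ∀ {Γ Δ₀ Δ₁} φ → Derivable Δ₀ → Δ₀ ⊆ φ ∷ Γ → Derivable Δ₁ → Δ₁ ⊆ neg φ ∷ Γ → Derivable Γ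
  cut-with φ (α , d , D) Δ₀⊆ (β , e , D′) Δ₁⊆ with upperBound α β
  ... | γ , α≼γ , β≼γ = γ +1 , suc (rk φ) ⊔ (d ⊔ e) , cut φ (m≤m⊔n (suc (rk φ)) (d ⊔ e))
    (prem α d _ (≼-≺-trans α≼γ (<+1 γ)) (m≤n⇒m≤o⊔n (suc (rk φ)) (m≤m⊔n d e)) Δ₀⊆ D)
    (prem β e _ (≼-≺-trans β≼γ (<+1 γ)) (m≤n⇒m≤o⊔n (suc (rk φ)) (m≤n⊔m d e)) Δ₁⊆ D′)

  cut-axioms : ∀ {C} As → All AxiomPAX As → Derivable (C ∷ map neg As) → Derivable (C ∷ [])
  cut-axioms []       []         D = D
  cut-axioms (A ∷ As) (axA ∷ axs) D = cut-axioms As axs (cut-with A (axiom-derivable axA) A⊆ D swap⊆)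
    where
    A⊆ : ∀ {x} → x ∈ A ∷ [] → x ∈ A ∷ _
    A⊆ (here refl) = ∈₀
    swap⊆ : ∀ {x} → x ∈ _ ∷ neg A ∷ map neg As → x ∈ neg A ∷ _ ∷ map neg As
    swap⊆ (here refl)         = ∈₁
    swap⊆ (there (here refl)) = ∈₀
    swap⊆ (there (there m))   = there (there m)

  theorem-derivable : ∀ {φ} → PAX⊢ φ → Derivable (φ ∷ [])
  theorem-derivable {φ} (As , axs , π) = cut-axioms As axs
    (fin (height π) , cutRank π ,
     subst (Der (fin (height π)) (cutRank π)) (map-sub-closed _ (φ ∷ map neg As))
           (embed-Tait π (λ ()) (height π) (cutRank π) ≤-refl ≤-refl))

  pairT : ∀ {n} → Tm n → Tm n → Fin 2 → Tm n
  pairT a b zero       = a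
  pairT a b (suc zero) = b

  lhd≡sub : ∀ {n} (a b : Tm n) → lhd lt a b ≡ sub (pairT a b) lt
  lhd≡sub a b = sub-cong (λ { zero → refl ; (suc zero) → refl }) lt

  lhd-instance : ∀ (s t : Tm 0) →
                 sub (inst s) (sub (liftS (inst t)) (neg (neg (lhd lt v0 v1)))) ≡ sub (pairT s t) lt
  lhd-instance s t = begin
    sub (inst s) (sub (liftS (inst t)) (neg (neg (lhd lt v0 v1))))
      ≡⟨ cong (sub (inst s) ∘ sub (liftS (inst t))) (trans (neg-involutive _) (lhd≡sub v0 v1)) ⟩
    sub (inst s) (sub (liftS (inst t)) (sub (pairT v0 v1) lt))
      ≡⟨ cong (sub (inst s)) (sub-⊙ (liftS (inst t)) (pairT v0 v1) lt) ⟩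
    sub (inst s) (sub (liftS (inst t) ⊙ pairT v0 v1) lt)
      ≡⟨ sub-⊙ (inst s) (liftS (inst t) ⊙ pairT v0 v1) lt ⟩
    sub (inst s ⊙ (liftS (inst t) ⊙ pairT v0 v1)) lt
      ≡⟨ sub-cong (λ { zero → refl ; (suc zero) → subT-inst-renT-suc s t }) lt ⟩
    sub (pairT s t) lt ∎
    where open ≡-Reasoning

  progressive : IsPA lt → Der (fin (6 + rk lt)) 0 (Prog lt ∷ [])
  progressive pa = ∀I _ ∈₀ λ t → premise₀ (∨I _ _ ∈₀ false (premise₀ (∨I _ _ ∈₁ true (premise₀ (XI t ∈₀ λ s s⊲t →
    premise₀ (∃I _ (there ∈₁) s (premise₀ (∧I _ _ ∈₀
      (premise₀ (truth lt pa (pairT s t) (Sat-cong (λ { zero → refl ; (suc zero) → refl }) lt s⊲t)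
                       (rk lt) ≤-refl (∈-≡ (lhd-instance s t) ∈₀)))
      (premise₀ (axX s s (there ∈₁) ∈₀ refl))))))))))

  all-X-from-counterexample : ∀ {Γ} k → ex (nX v0) ∈ Γ → all (X v0) ∈ Γ → Der (fin (2 + k)) 0 Γ
  all-X-from-counterexample k mex mall =
    ∀I _ mall λ t → premise₀ (∃I _ (there mex) t (premise₀ (axX t t ∈₁ ∈₀ refl)))

  TI⇒all-X : IsPA lt → Derivable (TI lt ∷ []) → Derivable (all (X v0) ∷ [])
  TI⇒all-X pa D = cut-with (TI lt) D (λ { (here refl) → ∈₀ }) (fin (7 + rk lt) , 0 , ¬TI-derivation) id
    where
    ¬TI-derivation : Der (fin (7 + rk lt)) 0 (neg (TI lt) ∷ all (X v0) ∷ [])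
    ¬TI-derivation = ∧I _ _ ∈₀
      (prem _ 0 _ (<+1 _) z≤n (λ { (here refl) → ∈-≡ (neg-involutive (Prog lt)) ∈₀ }) (progressive pa))
      (premise₀ (all-X-from-counterexample (4 + rk lt) ∈₀ (there (there ∈₀))))

-- Soundness of cut-free derivations for ⊲-ranks

module Soundness (lem : ExcludedMiddle 0ℓ) (O : OrdStruct) (lt : Fm 2) where
  open OrdStruct O
  open Infinitary O lt
  open IsWellOrder isWO using (tri) renaming (trans to ≺-trans)
  open WellOrder isWO

  data RankAtMost (n : ℕ) (γ : E) : Set where
    rankAtMost : (∀ m → m ⟨ lt ⟩ n → Σ E λ δ → δ ≺ γ × RankAtMost m δ) → RankAtMost n γ

  RankAtMost-mono : ∀ {n δ γ} → RankAtMost n δ → δ ≺ γ → RankAtMost n γ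
  RankAtMost-mono (rankAtMost below) δ≺γ =
    rankAtMost λ m m⊲n → let ε , ε≺δ , r = below m m⊲n in ε , ≺-trans ε≺δ δ≺γ , r

  ρ∅ : Fin 0 → ℕ
  ρ∅ ()

  _⊨_ : E → Sentence → Set
  γ ⊨ φ = Sat (λ n → RankAtMost n γ) ρ∅ φ

  _⊨any_ : E → Sequent → Set
  γ ⊨any Γ = Any (γ ⊨_) Γ

  ⊨any-mono : ∀ {α γ Γ} → All XPositive Γ → α ≺ γ → α ⊨any Γ → γ ⊨any Γ
  ⊨any-mono pos α≺γ a =
    let φ , m , h = find a in lose m (Sat-mono φ (lookup pos m) (λ _ r → RankAtMost-mono r α≺γ) h)

  -- The ∀- and X-rules have infinitely many premises, each of which may be witnessed either by
  -- its new formula or by the rest of the sequent; excluded middle picks one uniformly.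
  mutual
    sound : ∀ {γ Γ} → Der γ 0 Γ → All XPositive Γ → γ ⊨any Γ
    sound (axLit l m tl) pos      = lose m (TrueLit⇒Sat ρ∅ l tl)
    sound (axX _ _ _ mnX _) pos   = ⊥-elim (lookup pos mnX)
    sound (∧I a b m pa pb) pos with lookup pos m
    ... | xa , xb with sound-premise≼ pa (xa ∷ pos) | sound-premise≼ pb (xb ∷ pos)
    ... | here ha | here hb = lose m (ha , hb)
    ... | there r | _       = r
    ... | here _  | there r = r
    sound (∨I a b m false p) pos with sound-premise≼ p (proj₁ (lookup pos m) ∷ pos)
    ... | here ha = lose m (inj₁ ha)
    ... | there r = r
    sound (∨I a b m true p) pos with sound-premise≼ p (proj₂ (lookup pos m) ∷ pos)
    ... | here hb = lose m (inj₂ hb)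
    ... | there r = r
    sound {γ} {Γ} (∀I φ m ps) pos with lem {γ ⊨any Γ}
    ... | yes h = h
    ... | no ¬h = lose m all-instances
      where
      all-instances : ∀ k → Sat (λ n → RankAtMost n γ) (extend k ρ∅) φ
      all-instances k with sound-premise≼ (ps (num k)) (XPositive-sub (inst (num k)) φ (lookup pos m) ∷ pos)
      ... | here hk = subst (λ j → Sat (λ n → RankAtMost n γ) (extend j ρ∅) φ) (val-num k)
                            (Sat-inst ρ∅ ρ∅ φ (num k) hk)
      ... | there r = ⊥-elim (¬h r)
    sound (∃I φ m t p) pos with sound-premise≼ p (XPositive-sub (inst t) φ (lookup pos m) ∷ pos)
    ... | here ht = lose m (val t , Sat-inst ρ∅ ρ∅ φ t ht)
    ... | there r = r
    sound {γ} {Γ} (XI t m ps) pos with lem {γ ⊨any Γ}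
    ... | yes h = h
    ... | no ¬h = lose m (rankAtMost predecessor)
      where
      num-⊲ : ∀ {k} → k ⟨ lt ⟩ evalT ρ∅ t → val (num k) ⟨ lt ⟩ val t
      num-⊲ {k} = subst₂ (λ a b → a ⟨ lt ⟩ b) (sym (val-num k)) (evalT-closed ρ∅ t)
      predecessor : ∀ k → k ⟨ lt ⟩ evalT ρ∅ t → Σ E λ δ → δ ≺ γ × RankAtMost k δ
      predecessor k k⊲t with sound-premise (ps (num k) (num-⊲ k⊲t)) (tt ∷ pos)
      ... | α , α≺γ , here hk =
        α , α≺γ , subst (λ n → RankAtMost n α) (trans (evalT-closed ρ∅ (num k)) (val-num k)) hk
      ... | α , α≺γ , there r = ⊥-elim (¬h (⊨any-mono pos α≺γ r))
    sound (cut φ () p q) pos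

    sound-premise : ∀ {γ Γ} → Prem γ 0 Γ → All XPositive Γ → Σ E λ α → α ≺ γ × α ⊨any Γ
    sound-premise (prem α .0 Δ α≺γ z≤n Δ⊆ D) pos = α , α≺γ , Any-resp-⊆ Δ⊆ (sound D (anti-mono Δ⊆ pos))

    sound-premise≼ : ∀ {γ Γ} → Prem γ 0 Γ → All XPositive Γ → γ ⊨any Γ
    sound-premise≼ p pos = let α , α≺γ , h = sound-premise p pos in ⊨any-mono pos α≺γ h

  all-X-sound : ∀ {γ} → Der γ 0 (all (X v0) ∷ []) → ∀ n → RankAtMost n γ
  all-X-sound D with sound D (tt ∷ [])
  ... | here h = h

  rank-embedding : ∀ β → (∀ n → RankAtMost n β) → _≲_ (λ m n → m ⟨ lt ⟩ n) (_≺↾_ {β +1})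
  rank-embedding β ranked = (λ n → rank n , ≼-≺-trans (rank≼β n) (<+1 β)) , monotone
    where
    least : ∀ n → Σ E λ γ → RankAtMost n γ × γ ≼ β × (∀ δ → δ ≺ γ → ¬ RankAtMost n δ)
    least n = minimal lem (RankAtMost n) (ranked n)
    rank : ℕ → E
    rank n = proj₁ (least n)
    rank≼β : ∀ n → rank n ≼ β
    rank≼β n = proj₁ (proj₂ (proj₂ (least n)))
    monotone : ∀ a b → a ⟨ lt ⟩ b → rank a ≺ rank b
    monotone a b a⊲b with least a | least b
    ... | γ , _ , _ , minimal-γ | _ , rankAtMost below , _ with below a a⊲b
    ... | δ , δ≺rank-b , rank-a≤δ with tri γ δ
    ... | inj₁ γ≺δ        = ≺-trans γ≺δ δ≺rank-b
    ... | inj₂ (inj₁ refl) = δ≺rank-b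
    ... | inj₂ (inj₂ δ≺γ) = ⊥-elim (minimal-γ δ δ≺γ rank-a≤δ)

theorem3p12 : ExcludedMiddle 0ℓ →
    (O : OrdStruct) (lt : Fm 2) → IsPA lt →
    IsWellOrder (λ m n → m ⟨ lt ⟩ n) →
    (f : OrdStruct.E O → ℕ → OrdStruct.E O) →
    (∀ α d Γ → Infinitary.Der O lt α d Γ → Infinitary.Der O lt (f α d) 0 Γ) →
    ((PAX⊢ TI lt) →
       Σ (OrdStruct.E O) λ α →
         _≲_ (λ m n → m ⟨ lt ⟩ n) (OrdStruct._≺↾_ O {α}))
    × (_≲_ (OrdStruct._≺_ O) (λ m n → m ⟨ lt ⟩ n) → ¬ (PAX⊢ TI lt))
theorem3p12 lem O lt pa _ f cut-elimination = TI⇒embedding , E≲ℕ⇒TI-unprovable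
  where
  open OrdStruct O
  open Derivations O lt
  open Soundness lem O lt
  open WellOrder isWO

  TI⇒embedding : PAX⊢ TI lt → Σ E λ α → _≲_ (λ m n → m ⟨ lt ⟩ n) (_≺↾_ {α})
  TI⇒embedding ⊢TI with TI⇒all-X pa (theorem-derivable ⊢TI)
  ... | α , d , D = f α d +1 , rank-embedding (f α d) (all-X-sound (cut-elimination α d _ D))

  E≲ℕ⇒TI-unprovable : _≲_ _≺_ (λ m n → m ⟨ lt ⟩ n) → ¬ (PAX⊢ TI lt)
  E≲ℕ⇒TI-unprovable (e , e-mono) ⊢TI with TI⇒embedding ⊢TI
  ... | α , g , g-mono =
    selfEmbedding-noShrink (proj₁ ∘ g ∘ e) (λ a b a≺b → g-mono (e a) (e b) (e-mono a b a≺b))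
                           α (proj₂ (g (e α)))
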